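{- For every positive integer $n$ and every $p\in\mathbb{N}_0$, \begin{align*} \sum_{k=1}^nk^2H_{p+k}^2 &=\frac{(p+n+1)(2n^2+n-2pn+p+2p^2)}{6}H_{p+n}^2-\frac{p(p+1)(2p+1)}{6}H_{p}^2\\ &\quad-\frac{4n^3-3n^2-6pn^2-n+12pn+12p^2n+3+17p+33p^2+22p^3}{18}H_{p+n}\\ &\quad+\frac{(2p+1)(11p^2+11p+3)}{18}H_{p}+\frac{n(8n^2-15n-30pn+25+132p+132p^2)}{108}. \end{align*}
   Context: $H_0=0$ and $H_m=\sum_{j=1}^m \frac1j$ for $m\ge1$. -}

module Defs where

open import Data.Nat as ℕ using (ℕ; zero; suc)
open import Data.Integer as ℤ using (ℤ; +_)
open import Data.Rational using (ℚ; 0ℚ; 1ℚ; _+_; _*_; _/_)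

H : ℕ → ℚ
H zero    = 0ℚ
H (suc m) = H m + (+ 1) / suc m

sum1 : ℕ → (ℕ → ℚ) → ℚ
sum1 zero    f = 0ℚ
sum1 (suc n) f = sum1 n f + f (suc n)

⟦_⟧ : ℕ → ℚ
⟦ m ⟧ = (+ m) / 1

-- Write x = n, y = p, h = H (p + n), g = H p and let F(x, y, h, g) be the right-hand
-- side, a polynomial with rational coefficients. For n = 0 we have h = g and F vanishes
-- identically. Passing from n to n + 1 replaces x by 1 + x and h by h + u with
-- (1 + y + x) u = 1, and F(1 + x, y, h + u, g) − F(x, y, h, g) − (1 + x)² (h + u)² is an
-- explicit polynomial multiple of (1 + y + x) u − 1; so both facts are ring identities.

module Submission where

open import Defs
open import Data.Nat as ℕ using (ℕ; NonZero)
open import Data.Integer as ℤ using (ℤ; +_)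
open import Data.Rational using (ℚ; _+_; _-_; _*_; _/_)
open import Relation.Binary.PropositionalEquality using (_≡_)

open import Data.Nat using (zero; suc)
open import Data.Nat.Properties using (+-suc; +-identityʳ)
open import Data.Fin using (#_)
open import Data.Vec using (Vec; _∷_; [])
open import Data.Rational using (0ℚ; 1ℚ; -_; toℚᵘ)
open import Data.Rational.Properties
  using (toℚᵘ-injective; toℚᵘ-fromℚᵘ; toℚᵘ-homo-+; toℚᵘ-homo-*; toℚᵘ-homo‿-; *-zeroˡ)
  renaming (+-identityʳ to ℚ-+-identityʳ)
import Data.Rational.Unnormalised as ℚᵘ
import Data.Rational.Unnormalised.Properties as ℚᵘ
open import Data.Integer.Properties using (pos-*)
open import Data.Integer.Tactic.RingSolver using (solve-∀)
open import Data.Rational.Solver using (module +-*-Solver)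
open +-*-Solver using (Polynomial; con; var; _:+_; _:*_; _:-_; _:=_; solve)
  renaming (⟦_⟧ to ⟪_⟫)
open import Relation.Binary.PropositionalEquality
  using (refl; sym; trans; cong; cong₂; module ≡-Reasoning)

_/1 : ℤ → ℚ
i /1 = i / 1

toℚᵘ-/suc : ∀ i d → toℚᵘ (i / suc d) ℚᵘ.≃ ℚᵘ.mkℚᵘ i d
toℚᵘ-/suc i d = toℚᵘ-fromℚᵘ (ℚᵘ.mkℚᵘ i d)

/1-homo-+ : ∀ i j → (i ℤ.+ j) /1 ≡ i /1 + j /1
/1-homo-+ i j = toℚᵘ-injective (begin
  toℚᵘ ((i ℤ.+ j) /1)                       ≈⟨ toℚᵘ-/suc (i ℤ.+ j) 0 ⟩
  ℚᵘ.mkℚᵘ (i ℤ.+ j) 0                       ≈⟨ ℚᵘ.*≡* (lemma i j) ⟩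
  ℚᵘ.mkℚᵘ i 0 ℚᵘ.+ ℚᵘ.mkℚᵘ j 0              ≈⟨ ℚᵘ.+-cong (toℚᵘ-/suc i 0) (toℚᵘ-/suc j 0) ⟨
  toℚᵘ (i /1) ℚᵘ.+ toℚᵘ (j /1)              ≈⟨ toℚᵘ-homo-+ (i /1) (j /1) ⟨
  toℚᵘ (i /1 + j /1)                        ∎)
  where
  open ℚᵘ.≃-Reasoning
  lemma : ∀ i j → (i ℤ.+ j) ℤ.* + 1 ≡ (i ℤ.* + 1 ℤ.+ j ℤ.* + 1) ℤ.* + 1
  lemma = solve-∀

/1-homo-* : ∀ i j → (i ℤ.* j) /1 ≡ i /1 * j /1
/1-homo-* i j = toℚᵘ-injective (begin
  toℚᵘ ((i ℤ.* j) /1)                       ≈⟨ toℚᵘ-/suc (i ℤ.* j) 0 ⟩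
  ℚᵘ.mkℚᵘ (i ℤ.* j) 0                       ≈⟨ ℚᵘ.*≡* refl ⟩
  ℚᵘ.mkℚᵘ i 0 ℚᵘ.* ℚᵘ.mkℚᵘ j 0              ≈⟨ ℚᵘ.*-cong (toℚᵘ-/suc i 0) (toℚᵘ-/suc j 0) ⟨
  toℚᵘ (i /1) ℚᵘ.* toℚᵘ (j /1)              ≈⟨ toℚᵘ-homo-* (i /1) (j /1) ⟨
  toℚᵘ (i /1 * j /1)                        ∎)
  where open ℚᵘ.≃-Reasoning

/1-homo‿- : ∀ i → (ℤ.- i) /1 ≡ - (i /1)
/1-homo‿- i = toℚᵘ-injective (begin
  toℚᵘ ((ℤ.- i) /1)                         ≈⟨ toℚᵘ-/suc (ℤ.- i) 0 ⟩
  ℚᵘ.mkℚᵘ (ℤ.- i) 0                         ≈⟨ ℚᵘ.-‿cong (toℚᵘ-/suc i 0) ⟨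
  ℚᵘ.- toℚᵘ (i /1)                          ≈⟨ toℚᵘ-homo‿- (i /1) ⟨
  toℚᵘ (- (i /1))                           ∎)
  where open ℚᵘ.≃-Reasoning

i/n≡i*[1/n] : ∀ i d → i / suc d ≡ i /1 * (+ 1 / suc d)
i/n≡i*[1/n] i d = toℚᵘ-injective (begin
  toℚᵘ (i / suc d)                          ≈⟨ toℚᵘ-/suc i d ⟩
  ℚᵘ.mkℚᵘ i d                               ≈⟨ ℚᵘ.*≡* (lemma i (+ suc d)) ⟩
  ℚᵘ.mkℚᵘ i 0 ℚᵘ.* ℚᵘ.mkℚᵘ (+ 1) d          ≈⟨ ℚᵘ.*-cong (toℚᵘ-/suc i 0) (toℚᵘ-/suc (+ 1) d) ⟨
  toℚᵘ (i /1) ℚᵘ.* toℚᵘ (+ 1 / suc d)       ≈⟨ toℚᵘ-homo-* (i /1) (+ 1 / suc d) ⟨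
  toℚᵘ (i /1 * (+ 1 / suc d))               ∎)
  where
  open ℚᵘ.≃-Reasoning
  lemma : ∀ i n → i ℤ.* (+ 1 ℤ.* n) ≡ (i ℤ.* + 1) ℤ.* n
  lemma = solve-∀

n*[1/n]≡1 : ∀ m → ⟦ suc m ⟧ * (+ 1 / suc m) ≡ 1ℚ
n*[1/n]≡1 m = toℚᵘ-injective (begin
  toℚᵘ (⟦ suc m ⟧ * (+ 1 / suc m))          ≈⟨ toℚᵘ-homo-* ⟦ suc m ⟧ (+ 1 / suc m) ⟩
  toℚᵘ ⟦ suc m ⟧ ℚᵘ.* toℚᵘ (+ 1 / suc m)    ≈⟨ ℚᵘ.*-cong (toℚᵘ-/suc (+ suc m) 0) (toℚᵘ-/suc (+ 1) m) ⟩
  ℚᵘ.mkℚᵘ (+ suc m) 0 ℚᵘ.* ℚᵘ.mkℚᵘ (+ 1) m  ≈⟨ ℚᵘ.*≡* (lemma (+ suc m)) ⟩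
  ℚᵘ.1ℚᵘ                                    ∎)
  where
  open ℚᵘ.≃-Reasoning
  lemma : ∀ n → (n ℤ.* + 1) ℤ.* + 1 ≡ + 1 ℤ.* (+ 1 ℤ.* n)
  lemma = solve-∀

-- The coefficients are reified so that one syntax tree yields both the ℕ/ℤ expressions
-- of the statement and the polynomials handed to the ring solver.
infixl 6 _⊕_ _⊞_ _⊟_
infixl 7 _⊗_ _⊠_
infix  8 ⁺_

data ℕExpr : Set where
  `n `p : ℕExpr
  lit   : ℕ → ℕExpr
  _⊕_ _⊗_ : ℕExpr → ℕExpr → ℕExpr

data ℤExpr : Set where
  ⁺_ : ℕExpr → ℤExpr
  _⊞_ _⊠_ _⊟_ : ℤExpr → ℤExpr → ℤExpr

evalℕ : ℕExpr → ℕ → ℕ → ℕ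
evalℕ `n        n p = n
evalℕ `p        n p = p
evalℕ (lit m)   n p = m
evalℕ (e ⊕ e′)  n p = evalℕ e n p ℕ.+ evalℕ e′ n p
evalℕ (e ⊗ e′)  n p = evalℕ e n p ℕ.* evalℕ e′ n p

evalℤ : ℤExpr → ℕ → ℕ → ℤ
evalℤ (⁺ e)     n p = + evalℕ e n p
evalℤ (e ⊞ e′)  n p = evalℤ e n p ℤ.+ evalℤ e′ n p
evalℤ (e ⊠ e′)  n p = evalℤ e n p ℤ.* evalℤ e′ n p
evalℤ (e ⊟ e′)  n p = evalℤ e n p ℤ.- evalℤ e′ n p

module _ {m : ℕ} where

  polyℕ : ℕExpr → Polynomial m → Polynomial m → Polynomial m
  polyℕ `n        x y = x
  polyℕ `p        x y = y
  polyℕ (lit k)   x y = con ⟦ k ⟧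
  polyℕ (e ⊕ e′)  x y = polyℕ e x y :+ polyℕ e′ x y
  polyℕ (e ⊗ e′)  x y = polyℕ e x y :* polyℕ e′ x y

  polyℤ : ℤExpr → Polynomial m → Polynomial m → Polynomial m
  polyℤ (⁺ e)     x y = polyℕ e x y
  polyℤ (e ⊞ e′)  x y = polyℤ e x y :+ polyℤ e′ x y
  polyℤ (e ⊠ e′)  x y = polyℤ e x y :* polyℤ e′ x y
  polyℤ (e ⊟ e′)  x y = polyℤ e x y :- polyℤ e′ x y

module _ {m : ℕ} (n p : ℕ) (ρ : Vec ℚ m) where
  open ≡-Reasoning

  evalℕ-sound : ∀ e → ⟦ evalℕ e n p ⟧ ≡ ⟪ polyℕ e (var (# 0)) (var (# 1)) ⟫ (⟦ n ⟧ ∷ ⟦ p ⟧ ∷ ρ)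
  evalℕ-sound `n       = refl
  evalℕ-sound `p       = refl
  evalℕ-sound (lit k)  = refl
  evalℕ-sound (e ⊕ e′) = begin
    ⟦ evalℕ e n p ℕ.+ evalℕ e′ n p ⟧        ≡⟨ /1-homo-+ (+ evalℕ e n p) (+ evalℕ e′ n p) ⟩
    ⟦ evalℕ e n p ⟧ + ⟦ evalℕ e′ n p ⟧      ≡⟨ cong₂ _+_ (evalℕ-sound e) (evalℕ-sound e′) ⟩
    _                                       ∎
  evalℕ-sound (e ⊗ e′) = begin
    ⟦ evalℕ e n p ℕ.* evalℕ e′ n p ⟧        ≡⟨ cong _/1 (pos-* (evalℕ e n p) (evalℕ e′ n p)) ⟩
    (+ evalℕ e n p ℤ.* + evalℕ e′ n p) /1   ≡⟨ /1-homo-* (+ evalℕ e n p) (+ evalℕ e′ n p) ⟩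
    ⟦ evalℕ e n p ⟧ * ⟦ evalℕ e′ n p ⟧      ≡⟨ cong₂ _*_ (evalℕ-sound e) (evalℕ-sound e′) ⟩
    _                                       ∎

  evalℤ-sound : ∀ e → evalℤ e n p /1 ≡ ⟪ polyℤ e (var (# 0)) (var (# 1)) ⟫ (⟦ n ⟧ ∷ ⟦ p ⟧ ∷ ρ)
  evalℤ-sound (⁺ e)    = evalℕ-sound e
  evalℤ-sound (e ⊞ e′) = trans (/1-homo-+ (evalℤ e n p) (evalℤ e′ n p))
                               (cong₂ _+_ (evalℤ-sound e) (evalℤ-sound e′))
  evalℤ-sound (e ⊠ e′) = trans (/1-homo-* (evalℤ e n p) (evalℤ e′ n p))
                               (cong₂ _*_ (evalℤ-sound e) (evalℤ-sound e′))
  evalℤ-sound (e ⊟ e′) = begin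
    (evalℤ e n p ℤ.+ ℤ.- evalℤ e′ n p) /1   ≡⟨ /1-homo-+ (evalℤ e n p) (ℤ.- evalℤ e′ n p) ⟩
    evalℤ e n p /1 + (ℤ.- evalℤ e′ n p) /1  ≡⟨ cong (evalℤ e n p /1 +_) (/1-homo‿- (evalℤ e′ n p)) ⟩
    evalℤ e n p /1 - evalℤ e′ n p /1        ≡⟨ cong₂ _-_ (evalℤ-sound e) (evalℤ-sound e′) ⟩
    _                                       ∎

quadraticFactor coeff-Hₚ₊ₙ² coeff-Hₚ² coeff-Hₚ₊ₙ coeff-Hₚ coeff-1 : ℤExpr
quadraticFactor = ⁺ (lit 2 ⊗ `n ⊗ `n ⊕ `n ⊕ `p ⊕ lit 2 ⊗ `p ⊗ `p) ⊟ ⁺ (lit 2 ⊗ `p ⊗ `n)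
coeff-Hₚ₊ₙ² = ⁺ (`p ⊕ `n ⊕ lit 1) ⊠ quadraticFactor
coeff-Hₚ²   = ⁺ (`p ⊗ (`p ⊕ lit 1) ⊗ (lit 2 ⊗ `p ⊕ lit 1))
coeff-Hₚ₊ₙ  = ⁺ (lit 4 ⊗ `n ⊗ `n ⊗ `n ⊕ lit 12 ⊗ `p ⊗ `n ⊕ lit 12 ⊗ `p ⊗ `p ⊗ `n ⊕ lit 3
                ⊕ lit 17 ⊗ `p ⊕ lit 33 ⊗ `p ⊗ `p ⊕ lit 22 ⊗ `p ⊗ `p ⊗ `p)
              ⊟ ⁺ (lit 3 ⊗ `n ⊗ `n ⊕ lit 6 ⊗ `p ⊗ `n ⊗ `n ⊕ `n)
coeff-Hₚ    = ⁺ ((lit 2 ⊗ `p ⊕ lit 1) ⊗ (lit 11 ⊗ `p ⊗ `p ⊕ lit 11 ⊗ `p ⊕ lit 3))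
coeff-1     = ⁺ `n ⊠ (⁺ (lit 8 ⊗ `n ⊗ `n ⊕ lit 25 ⊕ lit 132 ⊗ `p ⊕ lit 132 ⊗ `p ⊗ `p)
                      ⊟ ⁺ (lit 15 ⊗ `n ⊕ lit 30 ⊗ `p ⊗ `n))

-- Definitionally the right-hand side of corollary12.
closedFormAt : ℕ → ℕ → ℚ
closedFormAt n p =
  (evalℤ coeff-Hₚ₊ₙ² n p / 6) * (H (p ℕ.+ n) * H (p ℕ.+ n))
  - (evalℤ coeff-Hₚ² n p / 6) * (H p * H p)
  - (evalℤ coeff-Hₚ₊ₙ n p / 18) * H (p ℕ.+ n)
  + (evalℤ coeff-Hₚ n p / 18) * H p
  + evalℤ coeff-1 n p / 108

module _ {m : ℕ} where

  closedFormPoly : (x y h g : Polynomial m) → Polynomial m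
  closedFormPoly x y h g =
    polyℤ coeff-Hₚ₊ₙ² x y :* con (+ 1 / 6) :* (h :* h)
    :- polyℤ coeff-Hₚ² x y :* con (+ 1 / 6) :* (g :* g)
    :- polyℤ coeff-Hₚ₊ₙ x y :* con (+ 1 / 18) :* h
    :+ polyℤ coeff-Hₚ x y :* con (+ 1 / 18) :* g
    :+ polyℤ coeff-1 x y :* con (+ 1 / 108)

  -- F(1 + x, y, h + u, g) − F(x, y, h, g) − (1 + x)² (h + u)² divided by (1 + y + x) u − 1.
  cofactor : (x y h u : Polynomial m) → Polynomial m
  cofactor x y h u =
    polyℤ quadraticFactor x y :* (con ⟦ 2 ⟧ :* h :+ u) :* con (+ 1 / 6)
    :- (con ⟦ 3 ⟧ :+ con ⟦ 17 ⟧ :* y :+ con ⟦ 22 ⟧ :* y :* y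
        :- x :- con ⟦ 10 ⟧ :* x :* y :+ con ⟦ 4 ⟧ :* x :* x) :* con (+ 1 / 18)

closedForm : (x y h g : ℚ) → ℚ
closedForm x y h g = ⟪ closedFormPoly (var (# 0)) (var (# 1)) (var (# 2)) (var (# 3)) ⟫ (x ∷ y ∷ h ∷ g ∷ [])

closedFormAt≡closedForm : ∀ n p → closedFormAt n p ≡ closedForm ⟦ n ⟧ ⟦ p ⟧ (H (p ℕ.+ n)) (H p)
closedFormAt≡closedForm n p =
  cong₂ _+_ (cong₂ _+_ (cong₂ _-_ (cong₂ _-_ (cong (_* (h * h)) (scaled coeff-Hₚ₊ₙ² 5))
                                            (cong (_* (g * g)) (scaled coeff-Hₚ² 5)))
                                  (cong (_* h) (scaled coeff-Hₚ₊ₙ 17)))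
                       (cong (_* g) (scaled coeff-Hₚ 17)))
            (scaled coeff-1 107)
  where
  h g : ℚ
  h = H (p ℕ.+ n)
  g = H p
  scaled : ∀ e d → evalℤ e n p / suc d
                 ≡ ⟪ polyℤ e (var (# 0)) (var (# 1)) ⟫ (⟦ n ⟧ ∷ ⟦ p ⟧ ∷ h ∷ g ∷ []) * (+ 1 / suc d)
  scaled e d = trans (i/n≡i*[1/n] (evalℤ e n p) d) (cong (_* (+ 1 / suc d)) (evalℤ-sound n p _ e))

closedForm-zero : ∀ y g → closedForm 0ℚ y g g ≡ 0ℚ
closedForm-zero = solve 2 (λ y g → closedFormPoly (con 0ℚ) y g g := con 0ℚ) refl

closedForm-suc : ∀ x y h g u → (1ℚ + y + x) * u ≡ 1ℚ →
  closedForm (1ℚ + x) y (h + u) g ≡ closedForm x y h g + (1ℚ + x) * (1ℚ + x) * ((h + u) * (h + u))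
closedForm-suc x y h g u [1+y+x]u≡1 =
  trans (solve 5 (λ x y h g u →
                    closedFormPoly (con 1ℚ :+ x) y (h :+ u) g
                    := closedFormPoly x y h g :+ (con 1ℚ :+ x) :* (con 1ℚ :+ x) :* ((h :+ u) :* (h :+ u))
                       :+ ((con 1ℚ :+ y :+ x) :* u :- con 1ℚ) :* cofactor x y h u)
                 refl x y h g u)
        (+-[t-1]*-vanishes _ _ _ [1+y+x]u≡1)
  where
  +-[t-1]*-vanishes : ∀ a t w → t ≡ 1ℚ → a + (t - 1ℚ) * w ≡ a
  +-[t-1]*-vanishes a _ w refl = trans (cong (_+_ a) (*-zeroˡ w)) (ℚ-+-identityʳ a)

⟦suc⟧≡1+⟦⟧ : ∀ m → ⟦ suc m ⟧ ≡ 1ℚ + ⟦ m ⟧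
⟦suc⟧≡1+⟦⟧ m = /1-homo-+ (+ 1) (+ m)

sum-closedForm : ∀ n p →
  sum1 n (λ k → ⟦ k ⟧ * ⟦ k ⟧ * (H (p ℕ.+ k) * H (p ℕ.+ k)))
  ≡ closedForm ⟦ n ⟧ ⟦ p ⟧ (H (p ℕ.+ n)) (H p)
sum-closedForm zero p = begin
  0ℚ                                        ≡⟨ closedForm-zero ⟦ p ⟧ (H p) ⟨
  closedForm 0ℚ ⟦ p ⟧ (H p) (H p)           ≡⟨ cong (λ k → closedForm 0ℚ ⟦ p ⟧ (H k) (H p)) (+-identityʳ p) ⟨
  closedForm 0ℚ ⟦ p ⟧ (H (p ℕ.+ 0)) (H p)   ∎
  where open ≡-Reasoning
sum-closedForm (suc n) p = begin
  sum1 n f + f (suc n)                                              ≡⟨ cong (_+ f (suc n)) (sum-closedForm n p) ⟩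
  closedForm ⟦ n ⟧ ⟦ p ⟧ h (H p) + f (suc n)                        ≡⟨ cong (_+_ (closedForm ⟦ n ⟧ ⟦ p ⟧ h (H p))) f-suc ⟩
  closedForm ⟦ n ⟧ ⟦ p ⟧ h (H p) + (1ℚ + ⟦ n ⟧) * (1ℚ + ⟦ n ⟧) * ((h + u) * (h + u))
                                                                    ≡⟨ closedForm-suc ⟦ n ⟧ ⟦ p ⟧ h (H p) u [1+p+n]u≡1 ⟨
  closedForm (1ℚ + ⟦ n ⟧) ⟦ p ⟧ (h + u) (H p)                       ≡⟨ cong₂ (λ x h′ → closedForm x ⟦ p ⟧ h′ (H p)) (⟦suc⟧≡1+⟦⟧ n) H-step ⟨
  closedForm ⟦ suc n ⟧ ⟦ p ⟧ (H (p ℕ.+ suc n)) (H p)                ∎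
  where
  open ≡-Reasoning
  f : ℕ → ℚ
  f k = ⟦ k ⟧ * ⟦ k ⟧ * (H (p ℕ.+ k) * H (p ℕ.+ k))
  h u : ℚ
  h = H (p ℕ.+ n)
  u = + 1 / suc (p ℕ.+ n)
  H-step : H (p ℕ.+ suc n) ≡ h + u
  H-step = cong H (+-suc p n)
  f-suc : f (suc n) ≡ (1ℚ + ⟦ n ⟧) * (1ℚ + ⟦ n ⟧) * ((h + u) * (h + u))
  f-suc = cong₂ (λ x h′ → x * x * (h′ * h′)) (⟦suc⟧≡1+⟦⟧ n) H-step
  [1+p+n]u≡1 : (1ℚ + ⟦ p ⟧ + ⟦ n ⟧) * u ≡ 1ℚ
  [1+p+n]u≡1 = begin
    (1ℚ + ⟦ p ⟧ + ⟦ n ⟧) * u  ≡⟨ cong (λ t → (t + ⟦ n ⟧) * u) (⟦suc⟧≡1+⟦⟧ p) ⟨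
    (⟦ suc p ⟧ + ⟦ n ⟧) * u   ≡⟨ cong (_* u) (/1-homo-+ (+ suc p) (+ n)) ⟨
    ⟦ suc (p ℕ.+ n) ⟧ * u     ≡⟨ n*[1/n]≡1 (p ℕ.+ n) ⟩
    1ℚ                        ∎

-- The identity also holds for n = 0.
corollary12 : (n p : ℕ) → .{{_ : NonZero n}} →
  sum1 n (λ k → ⟦ k ⟧ * ⟦ k ⟧ * (H (p ℕ.+ k) * H (p ℕ.+ k)))
  ≡ ((+ (p ℕ.+ n ℕ.+ 1) ℤ.* ((+ (2 ℕ.* n ℕ.* n ℕ.+ n ℕ.+ p ℕ.+ 2 ℕ.* p ℕ.* p)) ℤ.- + (2 ℕ.* p ℕ.* n))) / 6) * (H (p ℕ.+ n) * H (p ℕ.+ n))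
    - ((+ (p ℕ.* (p ℕ.+ 1) ℕ.* (2 ℕ.* p ℕ.+ 1))) / 6) * (H p * H p)
    - (((+ (4 ℕ.* n ℕ.* n ℕ.* n ℕ.+ 12 ℕ.* p ℕ.* n ℕ.+ 12 ℕ.* p ℕ.* p ℕ.* n ℕ.+ 3 ℕ.+ 17 ℕ.* p ℕ.+ 33 ℕ.* p ℕ.* p ℕ.+ 22 ℕ.* p ℕ.* p ℕ.* p)) ℤ.- (+ (3 ℕ.* n ℕ.* n ℕ.+ 6 ℕ.* p ℕ.* n ℕ.* n ℕ.+ n))) / 18) * H (p ℕ.+ n)
    + ((+ ((2 ℕ.* p ℕ.+ 1) ℕ.* (11 ℕ.* p ℕ.* p ℕ.+ 11 ℕ.* p ℕ.+ 3))) / 18) * H p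
    + ((+ n ℤ.* ((+ (8 ℕ.* n ℕ.* n ℕ.+ 25 ℕ.+ 132 ℕ.* p ℕ.+ 132 ℕ.* p ℕ.* p)) ℤ.- (+ (15 ℕ.* n ℕ.+ 30 ℕ.* p ℕ.* n)))) / 108)
corollary12 n p = trans (sum-closedForm n p) (sym (closedFormAt≡closedForm n p))
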